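{- Let $G$ be a graph and let $T\subseteq G$ be an induced subgraph which is a circle-tree. Let $P=(v(i):i<n)$ be a germ in $G$ and assume that $(P\cap T)\setminus\{v(n-1)\}\ne\emptyset$. Then every vertex of $P$ belongs to $T$.
   Context: Graphs are simple graphs with every vertex of finite degree; $\delta(x)=\delta_G(x)$ is the degree in $G$. A path is a sequence of pairwise distinct vertices with consecutive ones adjacent. A path $(v(i):i<n)$ is a germ in $G$ if $n\ge3$, $\delta(v(i))\le 2$ for all $i<n-1$, and $\delta(v(n-1))=3$. A circle is a finite connected graph in which every vertex has degree exactly $2$. For disjoint graphs $A,B$ with $\Delta(A),\Delta(B)\le3$ and vertices $x\in A$, $y\in B$ of degree $2$ in their respective graphs, $A+_{x,y}B$ is the disjoint union of $A$ and $B$ with the single extra edge $\{x,y\}$. A finite graph $T$ is a circle-tree if there are circles $C(0),\dots,C(k-1)$ ($k\ge1$) and graphs $T(0)=C(0)$, $T(i)=T(i-1)+_{x,y}C(i)$ for $0<i<k$ (with $C(i)$ disjoint from $T(i-1)$, $x\in T(i-1)$ of degree $2$ in $T(i-1)$, $y\in C(i)$), such that $T=T(k-1)$. -}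

module Defs where

open import Data.Nat using (ℕ; zero; suc; _≤_)
open import Data.Fin using (Fin; inject₁; fromℕ)
open import Data.List using (List; []; _∷_; length; _++_)
open import Data.List.Membership.Propositional using (_∈_; _∉_)
open import Data.List.Relation.Unary.Unique.Propositional using (Unique)
open import Data.Product using (Σ; ∃; _×_; _,_)
open import Function.Definitions using (Injective)
open import Relation.Binary.PropositionalEquality using (_≡_)
open import Relation.Nullary using (¬_)

-- A simple graph in which every vertex has finite degree:
-- each vertex comes with the (duplicate-free) finite list of its neighbours.
record Graph : Set₁ where
  field
    V       : Set
    nbrs    : V → List V
    nbrs-unique : ∀ x → Unique (nbrs x)
    irrefl  : ∀ x → x ∉ nbrs x
    sym     : ∀ x y → y ∈ nbrs x → x ∈ nbrs y

  Adj : V → V → Set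
  Adj x y = y ∈ nbrs x

  deg : V → ℕ
  deg x = length (nbrs x)

module _ (G : Graph) where
  open Graph G

  -- degree of x in the induced subgraph G[S] (S a finite vertex list) is d
  InducedDeg : List V → V → ℕ → Set
  InducedDeg S x d =
    Σ (List V) λ L → Unique L × (∀ y → (y ∈ L → Adj x y × y ∈ S) × (Adj x y × y ∈ S → y ∈ L))
                   × length L ≡ d

  data Reach (S : List V) : V → V → Set where
    here : ∀ {x} → x ∈ S → Reach S x x
    step : ∀ {x y z} → x ∈ S → Adj x y → Reach S y z → Reach S x z

  IsCircle : List V → Set
  IsCircle C = Unique C × ¬ (C ≡ [])
             × (∀ x y → x ∈ C → y ∈ C → Reach C x y)
             × (∀ x → x ∈ C → InducedDeg C x 2)

  Disjoint : List V → List V → Set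
  Disjoint A B = ∀ x → ¬ (x ∈ A × x ∈ B)

  -- CircleTree T : the induced subgraph G[T] is a circle-tree.
  -- glue: G[T ++ C] = G[T] +_{x,y} G[C], i.e. C is a circle disjoint from T,
  -- x has degree 2 in G[T], y ∈ C, {x,y} is an edge and it is the only
  -- edge of G between T and C.
  data CircleTree : List V → Set where
    base : ∀ C → IsCircle C → CircleTree C
    glue : ∀ T C x y → CircleTree T → IsCircle C → Disjoint T C
         → x ∈ T → y ∈ C → InducedDeg T x 2 → Adj x y
         → (∀ a b → a ∈ T → b ∈ C → Adj a b → a ≡ x × b ≡ y)
         → CircleTree (T ++ C)

  -- a germ (v(i) : i < n) with n = suc m; the last vertex is v (fromℕ m)
  record IsGerm (m : ℕ) (v : Fin (suc m) → V) : Set where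
    field
      length≥3 : 2 ≤ m
      injective : Injective _≡_ _≡_ v
      adjacent  : ∀ (i : Fin m) → Adj (v (inject₁ i)) (v (Fin.suc i))
      deg-inner : ∀ (i : Fin m) → deg (v (inject₁ i)) ≤ 2
      deg-last  : deg (v (fromℕ m)) ≡ 3

{-# OPTIONS --safe #-}
-- Every vertex of a circle-tree T has two distinct neighbours inside T (those on its own
-- circle), so a vertex of T of degree at most 2 in G has all its neighbours in T. The inner
-- vertices of a germ have degree at most 2, hence membership in T spreads from an inner
-- vertex of the germ back to v(0), and from there forward along the whole germ.
module Submission where

open import Defs
open import Level using (Level)
open import Data.Nat using (ℕ; zero; suc; _≤_; s≤s)
open import Data.Fin using (Fin; zero; suc; inject₁)
open import Data.Fin.Induction using (<-weakInduction)
open import Data.List using (List; []; _∷_; length)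
open import Data.List.Membership.Propositional using (_∈_)
open import Data.List.Membership.Propositional.Properties using (∈-++⁺ˡ; ∈-++⁺ʳ; ∈-++⁻)
open import Data.List.Relation.Binary.Subset.Propositional using (_⊆_)
open import Data.List.Relation.Unary.Any using (here; there)
open import Data.List.Relation.Unary.All using ([]; _∷_)
open import Data.List.Relation.Unary.AllPairs using ([]; _∷_)
open import Data.Product using (∃; ∃₂; _×_; _,_; proj₁)
open import Data.Sum using (inj₁; inj₂)
open import Relation.Binary.PropositionalEquality using (_≢_; refl)
open import Relation.Nullary using (contradiction)
open import Relation.Unary using (Pred)

private
  variable
    ℓ : Level
    A : Set ℓ

length≤2⇒⊆-pair : ∀ {L : List A} {a b} → length L ≤ 2 → a ∈ L → b ∈ L → a ≢ b →
                  L ⊆ a ∷ b ∷ []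
length≤2⇒⊆-pair {L = _ ∷ []}     _ (here refl)         (here refl)         a≢b _ = contradiction refl a≢b
length≤2⇒⊆-pair {L = _ ∷ _ ∷ []} _ (here refl)         (here refl)         a≢b _ = contradiction refl a≢b
length≤2⇒⊆-pair {L = _ ∷ _ ∷ []} _ (there (here refl)) (there (here refl)) a≢b _ = contradiction refl a≢b
length≤2⇒⊆-pair {L = _ ∷ _ ∷ []} _ (here refl)         (there (here refl)) _ (here refl)         = here refl
length≤2⇒⊆-pair {L = _ ∷ _ ∷ []} _ (here refl)         (there (here refl)) _ (there (here refl)) = there (here refl)
length≤2⇒⊆-pair {L = _ ∷ _ ∷ []} _ (there (here refl)) (here refl)         _ (here refl)         = there (here refl)
length≤2⇒⊆-pair {L = _ ∷ _ ∷ []} _ (there (here refl)) (here refl)         _ (there (here refl)) = here refl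
length≤2⇒⊆-pair {L = _ ∷ _ ∷ _ ∷ _} (s≤s (s≤s ())) _ _ _

>-weakInduction-toZero : ∀ {n} (P : Pred (Fin (suc n)) ℓ) →
                         (∀ i → P (suc i) → P (inject₁ i)) →
                         ∀ i → P i → P zero
>-weakInduction-toZero P Pᵢ₊₁⇒Pᵢ zero Pᵢ = Pᵢ
>-weakInduction-toZero {n = suc n} P Pᵢ₊₁⇒Pᵢ (suc i) Pᵢ₊₁ =
  >-weakInduction-toZero (λ j → P (inject₁ j)) (λ j → Pᵢ₊₁⇒Pᵢ (inject₁ j)) i (Pᵢ₊₁⇒Pᵢ i Pᵢ₊₁)

module _ (G : Graph) where
  open Graph G using (V; nbrs; Adj; deg)

  TwoNeighboursIn : List V → V → Set
  TwoNeighboursIn S x = ∃₂ λ a b → a ≢ b × (Adj x a × a ∈ S) × (Adj x b × b ∈ S)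

  inducedDeg2⇒twoNeighboursIn : ∀ {S x} → InducedDeg G S x 2 → TwoNeighboursIn S x
  inducedDeg2⇒twoNeighboursIn (a ∷ b ∷ [] , ((a≢b ∷ []) ∷ _) , spec , refl) =
    a , b , a≢b , proj₁ (spec a) (here refl) , proj₁ (spec b) (there (here refl))

  twoNeighboursIn-mono : ∀ {S S′ x} → S ⊆ S′ → TwoNeighboursIn S x → TwoNeighboursIn S′ x
  twoNeighboursIn-mono S⊆S′ (a , b , a≢b , (xa , a∈S) , (xb , b∈S)) =
    a , b , a≢b , (xa , S⊆S′ a∈S) , (xb , S⊆S′ b∈S)

  circleTree⇒twoNeighboursIn : ∀ {T x} → CircleTree G T → x ∈ T → TwoNeighboursIn T x
  circleTree⇒twoNeighboursIn (base C (_ , _ , _ , deg₂)) x∈C =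
    inducedDeg2⇒twoNeighboursIn (deg₂ _ x∈C)
  circleTree⇒twoNeighboursIn (glue T C _ _ tree (_ , _ , _ , deg₂) _ _ _ _ _ _) x∈T++C
    with ∈-++⁻ T x∈T++C
  ... | inj₁ x∈T = twoNeighboursIn-mono ∈-++⁺ˡ (circleTree⇒twoNeighboursIn tree x∈T)
  ... | inj₂ x∈C = twoNeighboursIn-mono (∈-++⁺ʳ T) (inducedDeg2⇒twoNeighboursIn (deg₂ _ x∈C))

  Deg≤2-Closed : List V → Set
  Deg≤2-Closed S = ∀ {x} → x ∈ S → deg x ≤ 2 → nbrs x ⊆ S

  twoNeighboursIn∧deg≤2⇒nbrs⊆ : ∀ {S x} → TwoNeighboursIn S x → deg x ≤ 2 → nbrs x ⊆ S
  twoNeighboursIn∧deg≤2⇒nbrs⊆ (a , b , a≢b , (xa , a∈S) , (xb , b∈S)) deg≤2 y∈nbrs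
    with length≤2⇒⊆-pair deg≤2 xa xb a≢b y∈nbrs
  ... | here refl         = a∈S
  ... | there (here refl) = b∈S

  circleTree⇒deg≤2-closed : ∀ {T} → CircleTree G T → Deg≤2-Closed T
  circleTree⇒deg≤2-closed tree x∈T =
    twoNeighboursIn∧deg≤2⇒nbrs⊆ (circleTree⇒twoNeighboursIn tree x∈T)

  germ⊆deg≤2-closed : ∀ {S m v} → Deg≤2-Closed S → IsGerm G m v →
                      (∃ λ (i : Fin m) → v (inject₁ i) ∈ S) → ∀ i → v i ∈ S
  germ⊆deg≤2-closed {m = zero} _ _ (() , _)
  germ⊆deg≤2-closed {S} {suc m} {v} closed germ (k , vₖ∈S) =
    <-weakInduction (λ i → v i ∈ S) v₀∈S forward
    where
    open IsGerm germ

    forward : ∀ (i : Fin (suc m)) → v (inject₁ i) ∈ S → v (suc i) ∈ S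
    forward i vᵢ∈S = closed vᵢ∈S (deg-inner i) (adjacent i)

    backward : ∀ (i : Fin m) → v (inject₁ (suc i)) ∈ S → v (inject₁ (inject₁ i)) ∈ S
    -- inject₁ (suc i) reduces to suc (inject₁ i), the right end of the edge adjacent (inject₁ i).
    backward i vᵢ₊₁∈S =
      closed vᵢ₊₁∈S (deg-inner (suc i)) (Graph.sym G _ _ (adjacent (inject₁ i)))

    v₀∈S : v zero ∈ S
    v₀∈S = >-weakInduction-toZero (λ i → v (inject₁ i) ∈ S) backward k vₖ∈S

lemma4p24 : (G : Graph) (T : List (Graph.V G)) → CircleTree G T
    → (m : ℕ) (v : Fin (suc m) → Graph.V G) → IsGerm G m v
    → (∃ λ (i : Fin m) → v (inject₁ i) ∈ T)
    → ∀ (i : Fin (suc m)) → v i ∈ T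
lemma4p24 G T tree m v germ = germ⊆deg≤2-closed G (circleTree⇒deg≤2-closed G tree) germ
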